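{- Let $x[1..n]$ be a framed word as described in the context. For every $r\in[2,n]$: (1) $\mathit{prev}_{ -1}[r]$ belongs to the PGS chain of $r-1$; (2) for every index $l$, $\mathit{next}_{ -1}[l]=r$ if and only if $l$ belongs to the PGS chain of $r-1$ and $l>\mathit{prev}_{ -1}[r]$.
   Context: Let $(\Sigma,<)$ be a totally ordered alphabet. The lexicographic order $\prec$ on words is: $u\prec v$ iff either $v=uw$ for some non-empty word $w$, or $u=ary$, $v=asy'$ for words $a,y,y'$ and letters $r<s$. A framed word is a word $x[1..n]$ ($n\ge 2$) with $x[1]=\#$, $x[n]=\$$ and $x[2..n-1]\in\Sigma^*$, where the order on $\Sigma$ is extended by $\# > \$ > a$ for all $a\in\Sigma$. For $1\le i\le n$, $x_i=x[i..n]$. The next greater suffix array is $\mathit{next}_{ -1}[i]=\min\{j\in(i,n]\mid x_j\succ x_i\}$, with $\mathit{next}_{ -1}[1]=\mathit{next}_{ -1}[n]=n+1$; the previous greater suffix array is $\mathit{prev}_{ -1}[i]=\max\{j\in[1,i)\mid x_j\succ x_i\}$, with $\mathit{prev}_{ -1}[1]=0$ and $\mathit{prev}_{ -1}[n]=1$. The PGS chain of an index $k$ is the sequence $k,\ \mathit{prev}_{ -1}[k],\ \mathit{prev}_{ -1}[\mathit{prev}_{ -1}[k]],\dots$ (iterating $\mathit{prev}_{ -1}$ zero or more times); the paper writes $\mathit{prev}_{ -1}^*[k]$ for an element of this chain. -}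

module Defs where

open import Level using (Level)
open import Data.Nat using (ℕ; zero; suc; _+_; _∸_; _≤_; _<_)
open import Data.List using (List; []; _∷_; _++_; [_]; map; drop; length)
open import Data.Product using (Σ; ∃; _×_; _,_)
open import Data.Sum using (_⊎_)
open import Relation.Binary.PropositionalEquality using (_≡_)
open import Relation.Nullary using (¬_)
open import Relation.Binary.Core using (Rel)

data Framed {a} (A : Set a) : Set a where
  hash   : Framed A
  dollar : Framed A
  ch     : A → Framed A

module _ {a ℓ} {A : Set a} (_<A_ : Rel A ℓ) where

  data _<F_ : Framed A → Framed A → Set (Level._⊔_ a ℓ) where
    ch<ch     : ∀ {r s} → r <A s → ch r <F ch s
    ch<dollar : ∀ {r} → ch r <F dollar
    ch<hash   : ∀ {r} → ch r <F hash
    dollar<hash : dollar <F hash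

  _≺_ : List (Framed A) → List (Framed A) → Set (Level._⊔_ a ℓ)
  u ≺ v =
      (Σ (List (Framed A)) λ w → (¬ (w ≡ [])) × (v ≡ u ++ w))
    ⊎ (Σ (List (Framed A)) λ p → Σ (List (Framed A)) λ y → Σ (List (Framed A)) λ y' →
        Σ (Framed A) λ r → Σ (Framed A) λ s →
          (r <F s) × (u ≡ p ++ (r ∷ y)) × (v ≡ p ++ (s ∷ y')))

  framed : List A → List (Framed A)
  framed w = hash ∷ (map ch w ++ [ dollar ])

  len : List A → ℕ
  len w = suc (suc (length w))

  -- suffix  x_i = x[i..n]  (1-based)
  suf : List A → ℕ → List (Framed A)
  suf w i = drop (i ∸ 1) (framed w)

  IsNext : List A → ℕ → ℕ → Set (Level._⊔_ a ℓ)
  IsNext w i j =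
      (i ≡ 1 × j ≡ suc (len w))
    ⊎ (i ≡ len w × j ≡ suc (len w))
    ⊎ (1 < i × i < len w × i < j × j ≤ len w
        × (suf w i ≺ suf w j)
        × (∀ k → i < k → k < j → ¬ (suf w i ≺ suf w k)))

  IsPrev : List A → ℕ → ℕ → Set (Level._⊔_ a ℓ)
  IsPrev w i j =
      (i ≡ 1 × j ≡ 0)
    ⊎ (i ≡ len w × j ≡ 1)
    ⊎ (1 < i × i < len w × 1 ≤ j × j < i
        × (suf w i ≺ suf w j)
        × (∀ k → j < k → k < i → ¬ (suf w i ≺ suf w k)))

  data InPGS (w : List A) (k : ℕ) : ℕ → Set (Level._⊔_ a ℓ) where
    here  : InPGS w k k
    there : ∀ {m l} → InPGS w k m → IsPrev w m l → InPGS w k l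

-- The frame makes x_1 the largest suffix and x_n the largest among x_2, …, x_{n-1}, so prev_{-1}
-- and next_{-1} are genuine previous/next greater-suffix pointers (apart from next at 1 and n).
-- The PGS chain of m = r - 1 is then exactly the set of right-to-left maxima of x_1, …, x_m, i.e.
-- the l ≤ m with x_k ≺ x_l for all l < k ≤ m. The position p = prev_{-1}[r] is one of them, since
-- x_k ≺ x_r ≺ x_p for p < k < r; and for such a maximum l, next_{-1}[l] = r iff x_l ≺ x_r iff l > p.
module Submission where

open import Defs
open import Level using (_⊔_)
open import Data.Nat using (ℕ; zero; suc; _+_; _≤_; _<_; _∸_; z≤n; s≤s)
open import Data.Nat.Properties
open import Data.Nat.Induction using (<-wellFounded)
open import Data.List using (List; []; _∷_; _++_; [_]; map; drop; length)
open import Data.List.Properties using (length-drop; length-++; length-map)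
open import Data.List.Relation.Binary.Lex.Core using (Lex-<; halt; this; next)
open import Data.List.Relation.Binary.Lex.Strict using () renaming (<-isStrictTotalOrder to Lex-isStrictTotalOrder)
open import Data.List.Relation.Binary.Pointwise using (Pointwise-≡⇒≡; ≡⇒Pointwise-≡)
open import Data.Product using (∃; _×_; _,_; proj₁; proj₂)
open import Data.Sum using (_⊎_; inj₁; inj₂; fromInj₁; fromInj₂)
open import Data.Empty using (⊥-elim)
open import Function using (_∘_)
open import Function.Bundles using (_⇔_; mk⇔)
open import Induction.WellFounded using (Acc; acc)
open import Relation.Nullary using (¬_; yes; no; contradiction)
open import Relation.Binary.PropositionalEquality
  using (_≡_; refl; cong; resp₂; isEquivalence; module ≡-Reasoning)
open import Relation.Binary.Core using (Rel)
open import Relation.Binary.Definitions using (Trichotomous; tri<; tri≈; tri>)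
open import Relation.Binary.Structures using (IsStrictTotalOrder)

module _ {a ℓ} {A : Set a} (_<A_ : Rel A ℓ) where

  ≺⇒Lex : ∀ {u v} → _≺_ _<A_ u v → Lex-< _≡_ (_<F_ _<A_) u v
  ≺⇒Lex {[]}    (inj₁ ([]    , w≢[] , _))    = contradiction refl w≢[]
  ≺⇒Lex {[]}    (inj₁ (_ ∷ _ , _    , refl)) = halt
  ≺⇒Lex {x ∷ u} (inj₁ (w , w≢[] , refl))     = next refl (≺⇒Lex {u} (inj₁ (w , w≢[] , refl)))
  ≺⇒Lex (inj₂ ([]    , _ , _ , _ , _ , r<s , refl , refl)) = this r<s
  ≺⇒Lex (inj₂ (x ∷ p , y , y′ , r , s , r<s , refl , refl)) =
    next refl (≺⇒Lex (inj₂ (p , y , y′ , r , s , r<s , refl , refl)))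

  Lex⇒≺ : ∀ {u v} → Lex-< _≡_ (_<F_ _<A_) u v → _≺_ _<A_ u v
  Lex⇒≺ (halt {y} {ys})            = inj₁ (y ∷ ys , (λ ()) , refl)
  Lex⇒≺ (this {x} {xs} {y} {ys} x<y) = inj₂ ([] , xs , ys , x , y , x<y , refl , refl)
  Lex⇒≺ (next {x} refl u<v) with Lex⇒≺ u<v
  ... | inj₁ (w , w≢[] , refl) = inj₁ (w , w≢[] , refl)
  ... | inj₂ (p , y , y′ , r , s , r<s , refl , refl) =
        inj₂ (x ∷ p , y , y′ , r , s , r<s , refl , refl)

module _ {a ℓ} {A : Set a} {_<A_ : Rel A ℓ} (sto : IsStrictTotalOrder _≡_ _<A_) where
  open IsStrictTotalOrder sto using (compare) renaming (trans to <A-trans; irrefl to <A-irrefl)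

  <F-isStrictTotalOrder : IsStrictTotalOrder _≡_ (_<F_ _<A_)
  <F-isStrictTotalOrder = record
    { isStrictPartialOrder = record
      { isEquivalence = isEquivalence
      ; irrefl        = irrefl
      ; trans         = trans
      ; <-resp-≈      = resp₂ (_<F_ _<A_)
      }
    ; compare = cmp
    }
    where
    irrefl : ∀ {x y} → x ≡ y → ¬ _<F_ _<A_ x y
    irrefl refl (ch<ch r<r) = <A-irrefl refl r<r

    trans : ∀ {x y z} → _<F_ _<A_ x y → _<F_ _<A_ y z → _<F_ _<A_ x z
    trans (ch<ch p) (ch<ch q) = ch<ch (<A-trans p q)
    trans (ch<ch _) ch<dollar = ch<dollar
    trans (ch<ch _) ch<hash   = ch<hash
    trans ch<dollar dollar<hash = ch<hash

    ch-injective : ∀ {r s : A} → ch r ≡ ch s → r ≡ s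
    ch-injective refl = refl

    ch<ch⁻¹ : ∀ {r s} → _<F_ _<A_ (ch r) (ch s) → r <A s
    ch<ch⁻¹ (ch<ch r<s) = r<s

    cmp : Trichotomous _≡_ (_<F_ _<A_)
    cmp hash     hash     = tri≈ (λ ()) refl (λ ())
    cmp hash     dollar   = tri> (λ ()) (λ ()) dollar<hash
    cmp hash     (ch _)   = tri> (λ ()) (λ ()) ch<hash
    cmp dollar   hash     = tri< dollar<hash (λ ()) (λ ())
    cmp dollar   dollar   = tri≈ (λ ()) refl (λ ())
    cmp dollar   (ch _)   = tri> (λ ()) (λ ()) ch<dollar
    cmp (ch _)   hash     = tri< ch<hash (λ ()) (λ ())
    cmp (ch _)   dollar   = tri< ch<dollar (λ ()) (λ ())
    cmp (ch r) (ch s) with compare r s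
    ... | tri< r<s r≢s r≯s = tri< (ch<ch r<s) (r≢s ∘ ch-injective) (r≯s ∘ ch<ch⁻¹)
    ... | tri≈ r≮s refl r≯s = tri≈ (r≮s ∘ ch<ch⁻¹) refl (r≯s ∘ ch<ch⁻¹)
    ... | tri> r≮s r≢s r>s = tri> (r≮s ∘ ch<ch⁻¹) (r≢s ∘ ch-injective) (ch<ch r>s)

  ≺-isStrictTotalOrder : IsStrictTotalOrder _≡_ (_≺_ _<A_)
  ≺-isStrictTotalOrder = record
    { isStrictPartialOrder = record
      { isEquivalence = isEquivalence
      ; irrefl        = λ { refl → Lex.irrefl (≡⇒Pointwise-≡ refl) ∘ ≺⇒Lex _<A_ }
      ; trans         = λ u≺v v≺t → Lex⇒≺ _<A_ (Lex.trans (≺⇒Lex _<A_ u≺v) (≺⇒Lex _<A_ v≺t))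
      ; <-resp-≈      = resp₂ (_≺_ _<A_)
      }
    ; compare = cmp
    }
    where
    module Lex = IsStrictTotalOrder (Lex-isStrictTotalOrder <F-isStrictTotalOrder)

    cmp : Trichotomous _≡_ (_≺_ _<A_)
    cmp u v with Lex.compare u v
    ... | tri< u<v u≉v u≯v = tri< (Lex⇒≺ _<A_ u<v) (u≉v ∘ ≡⇒Pointwise-≡) (u≯v ∘ ≺⇒Lex _<A_)
    ... | tri≈ u≮v u≈v u≯v = tri≈ (u≮v ∘ ≺⇒Lex _<A_) (Pointwise-≡⇒≡ u≈v) (u≯v ∘ ≺⇒Lex _<A_)
    ... | tri> u≮v u≉v u>v = tri> (u≮v ∘ ≺⇒Lex _<A_) (u≉v ∘ ≡⇒Pointwise-≡) (Lex⇒≺ _<A_ u>v)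

module Suffixes {a ℓ} {A : Set a} {_<A_ : Rel A ℓ} (sto : IsStrictTotalOrder _≡_ _<A_) (w : List A) where
  open IsStrictTotalOrder (≺-isStrictTotalOrder sto) using (compare)
    renaming (irrefl to ⊲-irrefl; asym to ⊲-asym; trans to ⊲-trans; _<?_ to _≺?_)

  n : ℕ
  n = len _<A_ w

  infix 4 _⊲_
  _⊲_ : ℕ → ℕ → Set (a ⊔ ℓ)
  i ⊲ j = _≺_ _<A_ (suf _<A_ w i) (suf _<A_ w j)

  body : List A → List (Framed A)
  body v = map ch v ++ [ dollar ]

  length-suf : ∀ i → length (suf _<A_ w (suc i)) ≡ n ∸ i
  length-suf i = begin
    length (drop i (framed _<A_ w))  ≡⟨ length-drop i (framed _<A_ w) ⟩
    suc (length (body w)) ∸ i        ≡⟨ cong (λ k → suc k ∸ i) (length-++ (map ch w)) ⟩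
    suc (length (map ch w) + 1) ∸ i  ≡⟨ cong (λ k → suc (k + 1) ∸ i) (length-map ch w) ⟩
    suc (length w + 1) ∸ i           ≡⟨ cong (λ k → suc k ∸ i) (+-comm (length w) 1) ⟩
    n ∸ i                            ∎
    where open ≡-Reasoning

  ⊲-connex : ∀ {i j} → 1 ≤ i → i < j → j ≤ n → i ⊲ j ⊎ j ⊲ i
  ⊲-connex {suc i} {suc j} _ (s≤s i<j) j<n with compare (suf _<A_ w (suc i)) (suf _<A_ w (suc j))
  ... | tri< i⊲j _ _ = inj₁ i⊲j
  ... | tri> _ _ j⊲i = inj₂ j⊲i
  ... | tri≈ _ same _ = contradiction (cong length same) (>⇒≢ shorter)
    where
    shorter : length (suf _<A_ w (suc j)) < length (suf _<A_ w (suc i))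
    shorter rewrite length-suf i | length-suf j = ∸-monoʳ-< i<j (<⇒≤ j<n)

  ¬⊳⇒⊲ : ∀ {i j} → 1 ≤ i → i < j → j ≤ n → ¬ j ⊲ i → i ⊲ j
  ¬⊳⇒⊲ 1≤i i<j j≤n ¬j⊲i = fromInj₁ (⊥-elim ∘ ¬j⊲i) (⊲-connex 1≤i i<j j≤n)

  ¬⊲⇒⊳ : ∀ {i j} → 1 ≤ i → i < j → j ≤ n → ¬ i ⊲ j → j ⊲ i
  ¬⊲⇒⊳ 1≤i i<j j≤n ¬i⊲j = fromInj₂ (⊥-elim ∘ ¬i⊲j) (⊲-connex 1≤i i<j j≤n)

  body<hash : ∀ v t {zs} → t ≤ length v → Lex-< _≡_ (_<F_ _<A_) (drop t (body v)) (hash ∷ zs)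
  body<hash []      zero    _         = this dollar<hash
  body<hash (_ ∷ _) zero    _         = this ch<hash
  body<hash (_ ∷ v) (suc t) (s≤s t≤v) = body<hash v t t≤v

  body<dollar : ∀ v t → t < length v → Lex-< _≡_ (_<F_ _<A_) (drop t (body v)) [ dollar ]
  body<dollar (_ ∷ _) zero    _         = this ch<dollar
  body<dollar (_ ∷ v) (suc t) (s≤s t<v) = body<dollar v t t<v

  drop-length-body : ∀ v → drop (length v) (body v) ≡ [ dollar ]
  drop-length-body []      = refl
  drop-length-body (_ ∷ v) = drop-length-body v

  hash-greatest : ∀ {k} → 1 < k → k ≤ n → k ⊲ 1
  hash-greatest {suc (suc t)} (s≤s (s≤s _)) (s≤s (s≤s t≤w)) = Lex⇒≺ _<A_ (body<hash w t t≤w)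

  dollar-greatest : ∀ {k} → 1 < k → k < n → k ⊲ n
  dollar-greatest {suc (suc t)} (s≤s (s≤s _)) (s≤s (s≤s t<w)) rewrite drop-length-body w =
    Lex⇒≺ _<A_ (body<dollar w t t<w)

  -- Position 0 is excluded explicitly because suf 0 = suf 1 (0 ∸ 1 = 0).
  PrevGreater : ℕ → ℕ → Set (a ⊔ ℓ)
  PrevGreater r p = 1 ≤ p × p < r × r ⊲ p × (∀ k → p < k → k < r → ¬ r ⊲ k)

  NextGreater : ℕ → ℕ → Set (a ⊔ ℓ)
  NextGreater l j = l < j × l ⊲ j × (∀ k → l < k → k < j → ¬ l ⊲ k)

  nextGreater-unique : ∀ {l j j′} → NextGreater l j → NextGreater l j′ → j ≡ j′
  nextGreater-unique {j = j} {j′} (l<j , l⊲j , none) (l<j′ , l⊲j′ , none′) with <-cmp j j′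
  ... | tri< j<j′ _ _ = contradiction l⊲j (none′ j l<j j<j′)
  ... | tri≈ _ j≡j′ _ = j≡j′
  ... | tri> _ _ j′<j = contradiction l⊲j′ (none j′ l<j′ j′<j)

  -- The framing makes the conventional values prev[n] = 1 genuine greater-suffix values.
  isPrev⇒prevGreater : ∀ {r p} → 1 < r → IsPrev _<A_ w r p → PrevGreater r p
  isPrev⇒prevGreater (s≤s ()) (inj₁ (refl , refl))
  isPrev⇒prevGreater 1<n (inj₂ (inj₁ (refl , refl))) =
    ≤-refl , 1<n , hash-greatest 1<n ≤-refl ,
    λ k 1<k k<n n⊲k → ⊲-asym n⊲k (dollar-greatest 1<k k<n)
  isPrev⇒prevGreater _ (inj₂ (inj₂ (_ , _ , prevGreater))) = prevGreater

  isNext-interior : ∀ {l j} → IsNext _<A_ w l j → j ≤ n → 1 < l × l < n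
  isNext-interior (inj₁ (_ , refl))        1+n≤n = contradiction 1+n≤n 1+n≰n
  isNext-interior (inj₂ (inj₁ (_ , refl))) 1+n≤n = contradiction 1+n≤n 1+n≰n
  isNext-interior (inj₂ (inj₂ (1<l , l<n , _))) _ = 1<l , l<n

  isNext⇒nextGreater : ∀ {l j} → 1 < l → l < n → IsNext _<A_ w l j → NextGreater l j
  isNext⇒nextGreater 1<1 _ (inj₁ (refl , _))        = contradiction 1<1 (<-irrefl refl)
  isNext⇒nextGreater _ n<n (inj₂ (inj₁ (refl , _))) = contradiction n<n (<-irrefl refl)
  isNext⇒nextGreater _ _ (inj₂ (inj₂ (_ , _ , l<j , _ , l⊲j , none))) = l<j , l⊲j , none

  prevGreater-exists : ∀ {m} → 1 < m → m ≤ n → ∃ (PrevGreater m)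
  prevGreater-exists {suc m} 1<m m≤n =
    search m ≤-refl (λ k m<k k≤m → contradiction (≤-pred k≤m) (<⇒≱ m<k))
    where
    search : ∀ t → t < suc m → (∀ k → t < k → k < suc m → ¬ suc m ⊲ k) → ∃ (PrevGreater (suc m))
    search zero    _   none = contradiction (hash-greatest 1<m m≤n) (none 1 (s≤s z≤n) 1<m)
    search (suc t) t<m none with suf _<A_ w (suc m) ≺? suf _<A_ w (suc t)
    ... | yes m⊲t = suc t , s≤s z≤n , t<m , m⊲t , none
    ... | no ¬m⊲t = search t (<-trans (n<1+n t) t<m) none′
      where
      none′ : ∀ k → t < k → k < suc m → ¬ suc m ⊲ k
      none′ k t<k k<m with m≤n⇒m<n∨m≡n t<k
      ... | inj₁ t+1<k = none k t+1<k k<m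
      ... | inj₂ refl  = ¬m⊲t

  Dominates : ℕ → ℕ → Set (a ⊔ ℓ)
  Dominates m l = ∀ k → l < k → k ≤ m → k ⊲ l

  prev-InPGS : ∀ {m q l} → IsPrev _<A_ w m q → InPGS _<A_ w q l → InPGS _<A_ w m l
  prev-InPGS m→q here         = there here m→q
  prev-InPGS m→q (there c q′→l) = there (prev-InPGS m→q c) q′→l

  dominates⇒InPGS : ∀ {m l} → 1 ≤ l → l ≤ m → m < n → Dominates m l → InPGS _<A_ w m l
  dominates⇒InPGS {m} = go (<-wellFounded m)
    where
    go : ∀ {m l} → Acc _<_ m → 1 ≤ l → l ≤ m → m < n → Dominates m l → InPGS _<A_ w m l
    go {m} {l} (acc rs) 1≤l l≤m m<n dom with m≤n⇒m<n∨m≡n l≤m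
    ... | inj₂ refl = here
    ... | inj₁ l<m with prevGreater-exists (≤-<-trans 1≤l l<m) (<⇒≤ m<n)
    ...   | q , prevGreater@(_ , q<m , _ , none) =
      prev-InPGS (inj₂ (inj₂ (≤-<-trans 1≤l l<m , m<n , prevGreater)))
        (go (rs q<m) 1≤l l≤q (<-trans q<m m<n)
          (λ k l<k k≤q → dom k l<k (≤-trans k≤q (<⇒≤ q<m))))
      where
      l≤q : l ≤ q
      l≤q = ≮⇒≥ (λ q<l → none l q<l l<m (dom m l<m ≤-refl))

  InPGS⇒dominates : ∀ {m l} → InPGS _<A_ w m l → 1 ≤ l → m < n → l ≤ m × Dominates m l
  InPGS⇒dominates here _ _ = ≤-refl , λ k l<k k≤l → contradiction k≤l (<⇒≱ l<k)
  InPGS⇒dominates (there c (inj₁ (refl , refl))) () _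
  InPGS⇒dominates (there c (inj₂ (inj₁ (refl , refl)))) _ m<n
    with InPGS⇒dominates c (s≤s z≤n) m<n
  ... | n≤m , _ = contradiction n≤m (<⇒≱ m<n)
  InPGS⇒dominates {m} {l} (there {q} c (inj₂ (inj₂ (_ , q<n , _ , l<q , q⊲l , none)))) 1≤l m<n
    with InPGS⇒dominates c (≤-trans 1≤l (<⇒≤ l<q)) m<n
  ... | q≤m , domq = ≤-trans (<⇒≤ l<q) q≤m , dom
    where
    dom : Dominates m l
    dom k l<k k≤m with <-cmp k q
    ... | tri< k<q _ _ = ⊲-trans (¬⊳⇒⊲ (≤-trans 1≤l (<⇒≤ l<k)) k<q (<⇒≤ q<n) (none k l<k k<q)) q⊲l
    ... | tri≈ _ refl _ = q⊲l
    ... | tri> _ _ q<k = ⊲-trans (domq k q<k k≤m) q⊲l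

  prevGreater⇒InPGS : ∀ {m p} → suc m ≤ n → PrevGreater (suc m) p → InPGS _<A_ w m p
  prevGreater⇒InPGS m<n (1≤p , p<r , r⊲p , none) = dominates⇒InPGS 1≤p (≤-pred p<r) m<n
    λ k p<k k≤m → ⊲-trans (¬⊳⇒⊲ (≤-trans 1≤p (<⇒≤ p<k)) (s≤s k≤m) m<n (none k p<k (s≤s k≤m))) r⊲p

  nextGreater⇒InPGS : ∀ {m p l} → suc m ≤ n → PrevGreater (suc m) p → 1 ≤ l →
                      NextGreater l (suc m) → InPGS _<A_ w m l × p < l
  nextGreater⇒InPGS {m} {p} {l} m<n (_ , p<r , r⊲p , _) 1≤l (l<r , l⊲r , none) =
    dominates⇒InPGS 1≤l (≤-pred l<r) m<n dom , p<l
    where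
    dom : Dominates m l
    dom k l<k k≤m = ¬⊲⇒⊳ 1≤l l<k (<⇒≤ (≤-trans (s≤s k≤m) m<n)) (none k l<k (s≤s k≤m))

    l⊲p : l ⊲ p
    l⊲p = ⊲-trans l⊲r r⊲p

    p<l : p < l
    p<l with <-cmp p l
    ... | tri< p<l _ _ = p<l
    ... | tri≈ _ refl _ = contradiction l⊲p (⊲-irrefl refl)
    ... | tri> _ _ l<p = contradiction l⊲p (none p l<p p<r)

  InPGS⇒nextGreater : ∀ {m p l} → suc m ≤ n → PrevGreater (suc m) p →
                      InPGS _<A_ w m l → p < l → NextGreater l (suc m)
  InPGS⇒nextGreater {m} {p} {l} m<n (1≤p , _ , _ , none) l∈chain p<l =
    s≤s l≤m , ¬⊳⇒⊲ 1≤l (s≤s l≤m) m<n (none l p<l (s≤s l≤m)) ,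
    λ k l<k k<r → ⊲-asym (dom k l<k (≤-pred k<r))
    where
    1≤l : 1 ≤ l
    1≤l = ≤-trans 1≤p (<⇒≤ p<l)
    chain : l ≤ m × Dominates m l
    chain = InPGS⇒dominates l∈chain 1≤l m<n
    l≤m : l ≤ m
    l≤m = proj₁ chain
    dom : Dominates m l
    dom = proj₂ chain

  isNext≡⇔InPGS : ∀ {m p l j} → suc m ≤ n → PrevGreater (suc m) p → IsNext _<A_ w l j →
                  (j ≡ suc m) ⇔ (InPGS _<A_ w m l × p < l)
  isNext≡⇔InPGS {m} {p} {l} {j} m<n prevGreater@(1≤p , _) isNext = mk⇔ to from
    where
    to : j ≡ suc m → InPGS _<A_ w m l × p < l
    to refl with isNext-interior isNext m<n
    ... | 1<l , l<n = nextGreater⇒InPGS m<n prevGreater (<⇒≤ 1<l) (isNext⇒nextGreater 1<l l<n isNext)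

    from : InPGS _<A_ w m l × p < l → j ≡ suc m
    from (l∈chain , p<l) = nextGreater-unique (isNext⇒nextGreater 1<l l<n isNext)
                                               (InPGS⇒nextGreater m<n prevGreater l∈chain p<l)
      where
      1<l : 1 < l
      1<l = ≤-<-trans 1≤p p<l
      l<n : l < n
      l<n = ≤-trans (s≤s (proj₁ (InPGS⇒dominates l∈chain (<⇒≤ 1<l) m<n))) m<n

lemma11 : ∀ {a ℓ} {A : Set a} (_<A_ : Rel A ℓ) → IsStrictTotalOrder _≡_ _<A_ →
    (w : List A) (r : ℕ) → 2 ≤ r → r ≤ len _<A_ w →
    (p : ℕ) → IsPrev _<A_ w r p →
      InPGS _<A_ w (r ∸ 1) p
      × (∀ l j → IsNext _<A_ w l j →
           (j ≡ r) ⇔ (InPGS _<A_ w (r ∸ 1) l × p < l))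
lemma11 _<A_ sto w (suc m) 1<r r≤n p isPrev =
  prevGreater⇒InPGS r≤n prevGreater , λ l j → isNext≡⇔InPGS r≤n prevGreater
  where
  open Suffixes sto w
  prevGreater : PrevGreater (suc m) p
  prevGreater = isPrev⇒prevGreater 1<r isPrev
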